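{- Let $p$ be an odd prime and let $1\le i\le p-1$. Consider a $p$-abacus (with a gap in position $0$) in which all beads are rightmost within their rows. Each of the following replacements, with all other rows kept unchanged and in the same order and beads still rightmost within their rows, strictly increases the size of the corresponding partition: (a) replacing $i$ consecutive rows each containing exactly $i+1$ gaps by $i+1$ consecutive rows each containing exactly $i$ gaps; (b) replacing $i$ consecutive rows each containing exactly $i+1$ beads by $i+1$ consecutive rows each containing exactly $i$ beads.
   Context: The $p$-abacus has runners $0,\dots,p-1$ and positions $n\ge0$, with position $n$ on runner $n\bmod p$ in row $\lfloor n/p\rfloor+1$; positions are ordered by $n$. Each position holds a bead or a gap, with finitely many beads. The abacus represents the partition whose parts are, for each bead, the number of gaps at smaller positions (nonzero parts only; with a gap at position $0$ every bead gives a positive part). Beads are rightmost within their rows if in each row the beads occupy the rightmost positions of that row. -}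

module Defs where

open import Data.Nat using (ℕ; zero; suc; _∸_; _≤_; _<_)
open import Data.Bool using (Bool; true; false)
open import Data.List using (List; []; _∷_; _++_; replicate; concatMap; filter; head)
open import Data.Maybe using (just)
open import Data.Nat.ListAction using (sum)
open import Relation.Binary.PropositionalEquality using (_≢_)
open import Data.Nat using (_≟_)
open import Relation.Nullary using (¬?)

-- An abacus all of whose beads are rightmost within their rows is given by the
-- list of bead counts of its rows 1,2,3,... (each count ≤ p); all rows beyond
-- the list are empty.  Positions are listed in increasing order as booleans
-- (true = bead, false = gap).

rowPattern : ℕ → ℕ → List Bool
rowPattern p b = replicate (p ∸ b) false ++ replicate b true

positions : ℕ → List ℕ → List Bool
positions p rows = concatMap (rowPattern p) rows

partsFrom : ℕ → List Bool → List ℕ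
partsFrom g []            = []
partsFrom g (false ∷ xs)  = partsFrom (suc g) xs
partsFrom g (true ∷ xs)   = g ∷ partsFrom g xs

partition : ℕ → List ℕ → List ℕ
partition p rows = filter (λ x → ¬? (x ≟ 0)) (partsFrom 0 (positions p rows))

size : ℕ → List ℕ → ℕ
size p rows = sum (partition p rows)

GapAt0 : ℕ → List ℕ → Set
GapAt0 p rows = head (positions p rows) ≢ just true

{-# OPTIONS --safe #-}
module Submission where

open import Defs
open import Data.Nat using (ℕ; zero; suc; _+_; _*_; _∸_; _≤_; _<_; s≤s; _≟_)
open import Data.Nat.Properties
open import Data.Nat.Primality using (Prime)
open import Data.Nat.Divisibility using (_∣_)
open import Data.Nat.ListAction using (sum)
open import Data.Nat.Tactic.RingSolver using (solve-∀)
open import Data.Bool using (Bool; true; false)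
open import Data.List using (List; []; _∷_; _++_; replicate; filter)
open import Data.List.Properties using (concatMap-++)
open import Data.List.Relation.Unary.All using (All)
open import Data.Product using (_×_; _,_)
open import Relation.Nullary using (¬_; ¬?)
open import Data.Empty using (⊥-elim)
open import Relation.Binary.PropositionalEquality

-- Each bead contributes the number of gaps before it.  A block of n rows with
-- b beads and c gaps each contributes b c n(n+1)/2 internally, plus b n times
-- the number of earlier gaps, and it delays every later bead by n c gaps.
-- Both replacements keep or increase the block's numbers of beads and gaps,
-- so no other bead loses, while the internal term grows from
-- k (i+1) · i(i+1)/2 to (k+1) i · (i+1)(i+2)/2, where k = p − 1 − i; this is
-- strict as i ≥ 1.

gaps : List Bool → ℕ
gaps []           = 0
gaps (false ∷ xs) = suc (gaps xs)
gaps (true ∷ xs)  = gaps xs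

beads : List Bool → ℕ
beads []           = 0
beads (false ∷ xs) = beads xs
beads (true ∷ xs)  = suc (beads xs)

partSum : ℕ → List Bool → ℕ
partSum g xs = sum (partsFrom g xs)

sum-filter-nonzero : ∀ ns → sum (filter (λ n → ¬? (n ≟ 0)) ns) ≡ sum ns
sum-filter-nonzero []            = refl
sum-filter-nonzero (zero ∷ ns)   = sum-filter-nonzero ns
sum-filter-nonzero (suc n ∷ ns)  = cong (suc n +_) (sum-filter-nonzero ns)

size≡partSum : ∀ p rows → size p rows ≡ partSum 0 (positions p rows)
size≡partSum p rows = sum-filter-nonzero (partsFrom 0 (positions p rows))

partSum-++ : ∀ g xs ys → partSum g (xs ++ ys) ≡ partSum g xs + partSum (gaps xs + g) ys
partSum-++ g []           ys = refl
partSum-++ g (false ∷ xs) ys =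
  trans (partSum-++ (suc g) xs ys) (cong (λ h → partSum (suc g) xs + partSum h ys) (+-suc (gaps xs) g))
partSum-++ g (true ∷ xs)  ys = trans (cong (g +_) (partSum-++ g xs ys)) (sym (+-assoc g _ _))

partSum-shift : ∀ g d xs → partSum (g + d) xs ≡ beads xs * d + partSum g xs
partSum-shift g d []           = refl
partSum-shift g d (false ∷ xs) = partSum-shift (suc g) d xs
partSum-shift g d (true ∷ xs)  = begin
  g + d + partSum (g + d) xs            ≡⟨ cong (g + d +_) (partSum-shift g d xs) ⟩
  g + d + (beads xs * d + partSum g xs) ≡⟨ regroup g d (beads xs * d) (partSum g xs) ⟩
  d + beads xs * d + (g + partSum g xs) ∎
  where
  open ≡-Reasoning
  regroup : ∀ a b c e → a + b + (c + e) ≡ b + c + (a + e)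
  regroup = solve-∀

partSum-monoˡ-≤ : ∀ {g h} xs → g ≤ h → partSum g xs ≤ partSum h xs
partSum-monoˡ-≤ {g} {h} xs g≤h = begin
  partSum g xs                      ≤⟨ m≤n+m _ _ ⟩
  beads xs * (h ∸ g) + partSum g xs ≡⟨ partSum-shift g (h ∸ g) xs ⟨
  partSum (g + (h ∸ g)) xs          ≡⟨ cong (λ z → partSum z xs) (m+[n∸m]≡n g≤h) ⟩
  partSum h xs                      ∎
  where open ≤-Reasoning

partSum-replace-< : ∀ g xs ys zs → gaps xs ≤ gaps ys → beads xs ≤ beads ys →
  partSum 0 xs < partSum 0 ys → partSum g (xs ++ zs) < partSum g (ys ++ zs)
partSum-replace-< g xs ys zs gaps≤ beads≤ sum< = begin-strict
  partSum g (xs ++ zs)                                      ≡⟨ partSum-++ g xs zs ⟩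
  partSum g xs + partSum (gaps xs + g) zs                   ≡⟨ cong (_+ partSum (gaps xs + g) zs) (partSum-shift 0 g xs) ⟩
  beads xs * g + partSum 0 xs + partSum (gaps xs + g) zs
    <⟨ +-mono-<-≤ (+-mono-≤-< (*-monoˡ-≤ g beads≤) sum<) (partSum-monoˡ-≤ zs (+-monoˡ-≤ g gaps≤)) ⟩
  beads ys * g + partSum 0 ys + partSum (gaps ys + g) zs    ≡⟨ cong (_+ partSum (gaps ys + g) zs) (partSum-shift 0 g ys) ⟨
  partSum g ys + partSum (gaps ys + g) zs                   ≡⟨ partSum-++ g ys zs ⟨
  partSum g (ys ++ zs)                                      ∎
  where open ≤-Reasoning

gaps-++ : ∀ xs ys → gaps (xs ++ ys) ≡ gaps xs + gaps ys
gaps-++ []           ys = refl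
gaps-++ (false ∷ xs) ys = cong suc (gaps-++ xs ys)
gaps-++ (true ∷ xs)  ys = gaps-++ xs ys

beads-++ : ∀ xs ys → beads (xs ++ ys) ≡ beads xs + beads ys
beads-++ []           ys = refl
beads-++ (false ∷ xs) ys = beads-++ xs ys
beads-++ (true ∷ xs)  ys = cong suc (beads-++ xs ys)

gaps-replicate-false : ∀ n → gaps (replicate n false) ≡ n
gaps-replicate-false zero    = refl
gaps-replicate-false (suc n) = cong suc (gaps-replicate-false n)

gaps-replicate-true : ∀ n → gaps (replicate n true) ≡ 0
gaps-replicate-true zero    = refl
gaps-replicate-true (suc n) = gaps-replicate-true n

beads-replicate-false : ∀ n → beads (replicate n false) ≡ 0
beads-replicate-false zero    = refl
beads-replicate-false (suc n) = beads-replicate-false n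

beads-replicate-true : ∀ n → beads (replicate n true) ≡ n
beads-replicate-true zero    = refl
beads-replicate-true (suc n) = cong suc (beads-replicate-true n)

partSum-replicate-false : ∀ g n ys → partSum g (replicate n false ++ ys) ≡ partSum (n + g) ys
partSum-replicate-false g zero    ys = refl
partSum-replicate-false g (suc n) ys = trans (partSum-replicate-false (suc g) n ys) (cong (λ h → partSum h ys) (+-suc n g))

partSum-replicate-true : ∀ g n → partSum g (replicate n true) ≡ n * g
partSum-replicate-true g zero    = refl
partSum-replicate-true g (suc n) = cong (g +_) (partSum-replicate-true g n)

gaps-rowPattern : ∀ p b → gaps (rowPattern p b) ≡ p ∸ b
gaps-rowPattern p b = begin
  gaps (replicate (p ∸ b) false ++ replicate b true)       ≡⟨ gaps-++ (replicate (p ∸ b) false) _ ⟩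
  gaps (replicate (p ∸ b) false) + gaps (replicate b true) ≡⟨ cong₂ _+_ (gaps-replicate-false (p ∸ b)) (gaps-replicate-true b) ⟩
  p ∸ b + 0                                                ≡⟨ +-identityʳ (p ∸ b) ⟩
  p ∸ b                                                    ∎
  where open ≡-Reasoning

beads-rowPattern : ∀ p b → beads (rowPattern p b) ≡ b
beads-rowPattern p b =
  trans (beads-++ (replicate (p ∸ b) false) _) (cong₂ _+_ (beads-replicate-false (p ∸ b)) (beads-replicate-true b))

partSum-rowPattern : ∀ g p b → partSum g (rowPattern p b) ≡ b * (p ∸ b + g)
partSum-rowPattern g p b =
  trans (partSum-replicate-false g (p ∸ b) (replicate b true)) (partSum-replicate-true (p ∸ b + g) b)

gaps-rows : ∀ p n b → gaps (positions p (replicate n b)) ≡ n * (p ∸ b)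
gaps-rows p zero    b = refl
gaps-rows p (suc n) b =
  trans (gaps-++ (rowPattern p b) _) (cong₂ _+_ (gaps-rowPattern p b) (gaps-rows p n b))

beads-rows : ∀ p n b → beads (positions p (replicate n b)) ≡ n * b
beads-rows p zero    b = refl
beads-rows p (suc n) b =
  trans (beads-++ (rowPattern p b) _) (cong₂ _+_ (beads-rowPattern p b) (beads-rows p n b))

partSum-rows : ∀ p n b → 2 * partSum 0 (positions p (replicate n b)) ≡ b * (p ∸ b) * (n * suc n)
partSum-rows p zero    b = sym (*-zeroʳ (b * (p ∸ b)))
partSum-rows p (suc n) b = begin
  2 * partSum 0 (rowPattern p b ++ rows)                         ≡⟨ cong (2 *_) (partSum-++ 0 (rowPattern p b) rows) ⟩
  2 * (partSum 0 (rowPattern p b) + partSum (gaps (rowPattern p b) + 0) rows)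
    ≡⟨ cong (λ h → 2 * (partSum 0 (rowPattern p b) + partSum (h + 0) rows)) (gaps-rowPattern p b) ⟩
  2 * (partSum 0 (rowPattern p b) + partSum (c + 0) rows)
    ≡⟨ cong₂ (λ u v → 2 * (u + v)) (partSum-rowPattern 0 p b) (partSum-shift 0 (c + 0) rows) ⟩
  2 * (b * (c + 0) + (beads rows * (c + 0) + partSum 0 rows))
    ≡⟨ cong (λ m → 2 * (b * (c + 0) + (m * (c + 0) + partSum 0 rows))) (beads-rows p n b) ⟩
  2 * (b * (c + 0) + (n * b * (c + 0) + partSum 0 rows))         ≡⟨ separate b c n (partSum 0 rows) ⟩
  2 * partSum 0 rows + b * c * (2 * suc n)                       ≡⟨ cong (_+ b * c * (2 * suc n)) (partSum-rows p n b) ⟩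
  b * c * (n * suc n) + b * c * (2 * suc n)                      ≡⟨ combine b c n ⟩
  b * c * (suc n * suc (suc n))                                  ∎
  where
  open ≡-Reasoning
  c    = p ∸ b
  rows = positions p (replicate n b)
  separate : ∀ b c n s → 2 * (b * (c + 0) + (n * b * (c + 0) + s)) ≡ 2 * s + b * c * (2 * suc n)
  separate = solve-∀
  combine : ∀ b c n → b * c * (n * suc n) + b * c * (2 * suc n) ≡ b * c * (suc n * suc (suc n))
  combine = solve-∀

positions-++ : ∀ p rows rows′ → positions p (rows ++ rows′) ≡ positions p rows ++ positions p rows′
positions-++ p = concatMap-++ (rowPattern p)

size-++-++ : ∀ p pre rows post → let P = positions p pre in
  size p (pre ++ rows ++ post) ≡ partSum 0 P + partSum (gaps P + 0) (positions p rows ++ positions p post)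
size-++-++ p pre rows post = begin
  size p (pre ++ rows ++ post)                                          ≡⟨ size≡partSum p (pre ++ rows ++ post) ⟩
  partSum 0 (positions p (pre ++ rows ++ post))                         ≡⟨ cong (partSum 0) layout ⟩
  partSum 0 (positions p pre ++ positions p rows ++ positions p post)   ≡⟨ partSum-++ 0 (positions p pre) _ ⟩
  partSum 0 (positions p pre) + partSum (gaps (positions p pre) + 0) (positions p rows ++ positions p post) ∎
  where
  open ≡-Reasoning
  layout : positions p (pre ++ rows ++ post) ≡ positions p pre ++ positions p rows ++ positions p post
  layout = trans (positions-++ p pre (rows ++ post)) (cong (positions p pre ++_) (positions-++ p rows post))

size-replaceRows-< : ∀ {p} pre post {n b c n′ b′ c′} → p ∸ b ≡ c → p ∸ b′ ≡ c′ →
  n * c ≤ n′ * c′ → n * b ≤ n′ * b′ → b * c * (n * suc n) < b′ * c′ * (n′ * suc n′) →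
  size p (pre ++ replicate n b ++ post) < size p (pre ++ replicate n′ b′ ++ post)
size-replaceRows-< {p} pre post {n} {b} {_} {n′} {b′} refl refl gaps≤ beads≤ block< = begin-strict
  size p (pre ++ replicate n b ++ post)                  ≡⟨ size-++-++ p pre (replicate n b) post ⟩
  partSum 0 P + partSum (gaps P + 0) (rows n b ++ Q)
    <⟨ +-monoʳ-< (partSum 0 P) (partSum-replace-< (gaps P + 0) (rows n b) (rows n′ b′) Q
         (subst₂ _≤_ (sym (gaps-rows p n b)) (sym (gaps-rows p n′ b′)) gaps≤)
         (subst₂ _≤_ (sym (beads-rows p n b)) (sym (beads-rows p n′ b′)) beads≤)
         (*-cancelˡ-< 2 _ _ (subst₂ _<_ (sym (partSum-rows p n b)) (sym (partSum-rows p n′ b′)) block<))) ⟩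
  partSum 0 P + partSum (gaps P + 0) (rows n′ b′ ++ Q)   ≡⟨ size-++-++ p pre (replicate n′ b′) post ⟨
  size p (pre ++ replicate n′ b′ ++ post)                ∎
  where
  open ≤-Reasoning
  P = positions p pre
  Q = positions p post
  rows : ℕ → ℕ → List Bool
  rows m a = positions p (replicate m a)

block-growth : ∀ k i → 1 ≤ i → k * suc i * (i * suc i) < suc k * i * (suc i * suc (suc i))
block-growth k i@(suc _) _ = begin-strict
  k * suc i * (i * suc i)          ≡⟨ reorder k i ⟩
  k * (i * suc i) * suc i          ≤⟨ *-monoʳ-≤ (k * (i * suc i)) (n≤1+n (suc i)) ⟩
  k * (i * suc i) * suc (suc i)    <⟨ *-monoˡ-< (suc (suc i)) (*-monoˡ-< (i * suc i) (n<1+n k)) ⟩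
  suc k * (i * suc i) * suc (suc i) ≡⟨ regroup (suc k) i ⟩
  suc k * i * (suc i * suc (suc i)) ∎
  where
  open ≤-Reasoning
  reorder : ∀ k i → k * suc i * (i * suc i) ≡ k * (i * suc i) * suc i
  reorder = solve-∀
  regroup : ∀ m i → m * (i * suc i) * suc (suc i) ≡ m * i * (suc i * suc (suc i))
  regroup = solve-∀

m+n≡o⇒o∸m≡n : ∀ {m n o} → m + n ≡ o → o ∸ m ≡ n
m+n≡o⇒o∸m≡n {m} {n} refl = m+n∸m≡n m n

≤pred⇒< : ∀ {m n} → 1 ≤ m → m ≤ n ∸ 1 → m < n
≤pred⇒< {n = zero}  1≤m m≤0 = ⊥-elim (n≮0 (≤-trans 1≤m m≤0))
≤pred⇒< {n = suc _} _   m≤n = s≤s m≤n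

lemma4p7 : (p i : ℕ) → Prime p → ¬ (2 ∣ p) → 1 ≤ i → i ≤ p ∸ 1 →
    (pre post : List ℕ) → All (_≤ p) pre → All (_≤ p) post →
    (GapAt0 p (pre ++ replicate i (p ∸ suc i) ++ post) →
    size p (pre ++ replicate i (p ∸ suc i) ++ post)
    < size p (pre ++ replicate (suc i) (p ∸ i) ++ post))
    × (GapAt0 p (pre ++ replicate i (suc i) ++ post) →
    size p (pre ++ replicate i (suc i) ++ post)
    < size p (pre ++ replicate (suc i) i ++ post))
lemma4p7 p i _ _ 1≤i i≤p∸1 pre post _ _ = (λ _ → gapRows) , (λ _ → beadRows)
  where
  k = p ∸ suc i
  1+i+k≡p : suc i + k ≡ p
  1+i+k≡p = m+[n∸m]≡n (≤pred⇒< 1≤i i≤p∸1)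
  i+1+k≡p : i + suc k ≡ p
  i+1+k≡p = trans (+-suc i k) 1+i+k≡p
  p∸i≡1+k : p ∸ i ≡ suc k
  p∸i≡1+k = m+n≡o⇒o∸m≡n i+1+k≡p
  i*k≤[1+i]*[1+k] : i * k ≤ suc i * suc k
  i*k≤[1+i]*[1+k] = *-mono-≤ (n≤1+n i) (n≤1+n k)
  gapRows : size p (pre ++ replicate i k ++ post) < size p (pre ++ replicate (suc i) (p ∸ i) ++ post)
  gapRows rewrite p∸i≡1+k =
    size-replaceRows-< pre post
      (m+n≡o⇒o∸m≡n (trans (+-comm k (suc i)) 1+i+k≡p)) (m+n≡o⇒o∸m≡n (trans (+-comm (suc k) i) i+1+k≡p))
      (≤-reflexive (*-comm i (suc i))) i*k≤[1+i]*[1+k] (block-growth k i 1≤i)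
  beadRows : size p (pre ++ replicate i (suc i) ++ post) < size p (pre ++ replicate (suc i) i ++ post)
  beadRows = size-replaceRows-< pre post refl p∸i≡1+k i*k≤[1+i]*[1+k] (≤-reflexive (*-comm i (suc i)))
    (subst₂ _<_ (cong (_* (i * suc i)) (*-comm k (suc i))) (cong (_* (suc i * suc (suc i))) (*-comm (suc k) i)) (block-growth k i 1≤i))
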